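{- Space parallelisation is not associative: it is not the case that for all computon spaces $S_1,S_2,S_3$ one has $\mathrm{Par}(S_1,\mathrm{Par}(S_2,S_3))=\mathrm{Par}(\mathrm{Par}(S_1,S_2),S_3)$.
   Context: A computon space is a set of computons. For computon spaces $S_1,\ldots,S_n$ ($n\ge 2$) with $A=\{S_1,\ldots,S_n\}$, a parallel computon over $A$ is a partial or total function from $A$ to $\mathbb{Z}^+$ with nonempty domain. The paralleliser operator is defined by $\mathrm{Par}(S_1,\ldots,S_n)=$ the set of all parallel computons over $\{S_1,\ldots,S_n\}$; it is itself a computon space. A computon space is never an element of the set of spaces on which its own computons are defined (so e.g. $S_1\neq \mathrm{Par}(S_1,S_2)$). -}

module Defs where

open import Data.Nat.Base using (ℕ; NonZero)
open import Data.Product using (Σ; Σ-syntax; ∃; ∃-syntax; _×_; _,_)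
open import Data.Sum using (_⊎_)
open import Data.List using (List; [])
open import Data.List.Membership.Propositional using (_∈_)
open import Data.List.Relation.Unary.All using (All)
open import Relation.Nullary using (¬_)
open import Function.Bundles using (_⇔_)
open import Relation.Binary.PropositionalEquality using (_≡_; _≢_)

ℤ⁺ : Set
ℤ⁺ = Σ[ n ∈ ℕ ] NonZero n

-- An axiomatic universe of computons and computon spaces.
--  * A computon space is a set of computons: membership + extensionality.
--  * A (finite) partial function from spaces to ℤ⁺ is identified with its
--    graph, a finite list of pairs (S , n); two such computons are equal
--    exactly when their graphs contain the same pairs.
--  * Par S₁ S₂ is the set of all parallel computons over {S₁ , S₂}, i.e.
--    functional graphs with nonempty domain contained in {S₁ , S₂}.
--  * Foundation: a computon space is never an element of the set of spaces
--    on which its own computons are defined: Par S₁ S₂ ∉ {S₁ , S₂}.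
record ComputonUniverse : Set₁ where
  field
    Computon : Set
    Space    : Set
    _∈ₛ_     : Computon → Space → Set
    space-ext : ∀ {S T : Space} → (∀ c → (c ∈ₛ S) ⇔ (c ∈ₛ T)) → S ≡ T
    ∅        : Space
    ∅-empty  : ∀ c → ¬ (c ∈ₛ ∅)

  Graph : Set
  Graph = List (Space × ℤ⁺)

  Functional : Graph → Set
  Functional g = ∀ {S m n} → (S , m) ∈ g → (S , n) ∈ g → m ≡ n

  DomainIn : Space → Space → Graph → Set
  DomainIn S₁ S₂ g = All (λ { (S , _) → S ≡ S₁ ⊎ S ≡ S₂ }) g

  field
    fun       : Graph → Computon
    fun-ext   : ∀ {g h : Graph} → (∀ p → (p ∈ g) ⇔ (p ∈ h)) → fun g ≡ fun h
    fun-inj   : ∀ {g h : Graph} → fun g ≡ fun h → ∀ p → (p ∈ g) ⇔ (p ∈ h)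
    Par       : Space → Space → Space
    Par-def   : ∀ {S₁ S₂ : Space} c →
                (c ∈ₛ Par S₁ S₂) ⇔
                (∃[ g ] (c ≡ fun g × Functional g × g ≢ [] × DomainIn S₁ S₂ g))
    foundation : ∀ {S₁ S₂ : Space} → Par S₁ S₂ ≢ S₁ × Par S₁ S₂ ≢ S₂

module Submission where

-- With P = Par ∅ ∅, the computon {∅ ↦ 1} lies in Par ∅ (Par ∅ P), since its
-- domain is {∅}. Associativity would put it in Par (Par ∅ ∅) P = Par P P,
-- forcing ∅ = P = Par ∅ ∅, which foundation forbids.

open import Defs
open import Relation.Nullary using (¬_)
open import Relation.Binary.PropositionalEquality using (_≡_; refl; sym; subst)
open import Data.Nat.Base using (suc; zero)
open import Data.Product using (_,_; proj₁)
open import Data.Sum using (_⊎_; inj₁) renaming ([_,_] to either)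
open import Data.List using ([_])
open import Data.List.Relation.Unary.Any using (here)
open import Data.List.Relation.Unary.All as All using ([])
open import Function.Bundles using (Equivalence)

one : ℤ⁺
one = suc zero , _

module _ (U : ComputonUniverse) where
  open ComputonUniverse U

  singleton : Space → ℤ⁺ → Computon
  singleton S n = fun [ S , n ]

  singleton-functional : ∀ S n → Functional [ S , n ]
  singleton-functional S n (here refl) (here refl) = refl

  singleton∈Par-left : ∀ {S₁ S₂} n → singleton S₁ n ∈ₛ Par S₁ S₂
  singleton∈Par-left {S₁} n = Equivalence.from (Par-def _)
    ([ S₁ , n ] , refl , singleton-functional S₁ n , (λ ()) , inj₁ refl All.∷ [])

  singleton∈Par⇒domain : ∀ {S S₁ S₂} n → singleton S n ∈ₛ Par S₁ S₂ → S ≡ S₁ ⊎ S ≡ S₂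
  singleton∈Par⇒domain {S} n c∈ with Equivalence.to (Par-def _) c∈
  ... | g , c≡fun-g , _ , _ , dom =
    All.lookup dom (Equivalence.to (fun-inj c≡fun-g (S , n)) (here refl))

proposition8 : (U : ComputonUniverse) →
    ¬ (∀ (S₁ S₂ S₃ : ComputonUniverse.Space U) →
    ComputonUniverse.Par U S₁ (ComputonUniverse.Par U S₂ S₃)
    ≡ ComputonUniverse.Par U (ComputonUniverse.Par U S₁ S₂) S₃)
proposition8 U assoc = either ∅≢P ∅≢P (singleton∈Par⇒domain U one c∈PP)
  where
  open ComputonUniverse U
  P : Space
  P = Par ∅ ∅
  c∈PP : singleton U ∅ one ∈ₛ Par P P
  c∈PP = subst (singleton U ∅ one ∈ₛ_) (assoc ∅ ∅ P) (singleton∈Par-left U one)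
  ∅≢P : ¬ ∅ ≡ P
  ∅≢P ∅≡P = proj₁ foundation (sym ∅≡P)
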